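{- Let $H$ be a graph and let $H'$ be a graph obtained from $H$ by applying any (finite) sequence of Operations I and II. If $\mathcal{D}(H')$ has a Hamilton path, then $\mathcal{D}(H)$ has a Hamilton path.
   Context: All graphs are finite and simple; $N_H(y)$ denotes the set of neighbours of $y$ in $H$. Operation I: if a graph $H$ has distinct vertices $u,v,x$ with $N_H(u)=N_H(v)=\{x\}$, replace $H$ by $H-v$. Operation II: if a graph $H$ has distinct vertices $u,v,w$ with $N_H(v)=\{u,w\}$ and $N_H(w)=\{v\}$, replace $H$ by $H-w-v$. A dominating set of $H$ is a set $D\subseteq V(H)$ such that every vertex of $V(H)\setminus D$ is adjacent to a vertex of $D$. The dominating graph $\mathcal{D}(H)$ is the graph whose vertices are all dominating sets of $H$, in which two distinct dominating sets $X,Y$ are adjacent if and only if $|X\triangle Y|=1$. -}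

module Defs where

open import Data.Nat using (ℕ; suc)
open import Data.Bool using (Bool; true; false; _xor_)
open import Data.Fin using (Fin; punchIn; punchOut)
open import Data.Fin.Subset using (Subset; _∈_; ∣_∣)
open import Data.Vec using (zipWith)
open import Data.List using (List)
open import Data.List.Relation.Unary.All using (All)
open import Data.List.Relation.Unary.Linked using (Linked)
open import Data.List.Relation.Unary.Unique.Propositional using (Unique)
open import Data.List.Membership.Propositional renaming (_∈_ to _∈ₗ_)
open import Data.Product using (Σ; ∃; _×_)
open import Data.Sum using (_⊎_)
open import Relation.Binary.PropositionalEquality using (_≡_; _≢_)

record Graph (n : ℕ) : Set where
  field
    Adj    : Fin n → Fin n → Bool
    sym    : ∀ i j → Adj i j ≡ Adj j i
    irrefl : ∀ i → Adj i i ≡ false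
open Graph public

delete : ∀ {n} → Graph (suc n) → Fin (suc n) → Graph n
delete H v = record
  { Adj    = λ i j → Adj H (punchIn v i) (punchIn v j)
  ; sym    = λ i j → sym H (punchIn v i) (punchIn v j)
  ; irrefl = λ i → irrefl H (punchIn v i)
  }

NbhdIs₁ : ∀ {n} → Graph n → Fin n → Fin n → Set
NbhdIs₁ H y x = ∀ z → (Adj H y z ≡ true → z ≡ x) × (z ≡ x → Adj H y z ≡ true)

NbhdIs₂ : ∀ {n} → Graph n → Fin n → Fin n → Fin n → Set
NbhdIs₂ H y x x' =
  ∀ z → (Adj H y z ≡ true → z ≡ x ⊎ z ≡ x') × (z ≡ x ⊎ z ≡ x' → Adj H y z ≡ true)

data Reduces : ∀ {m n} → Graph m → Graph n → Set where
  done : ∀ {n} {H : Graph n} → Reduces H H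
  opI  : ∀ {m n} {H : Graph (suc m)} {H' : Graph n} (u v x : Fin (suc m)) →
         u ≢ v → u ≢ x → v ≢ x →
         NbhdIs₁ H u x → NbhdIs₁ H v x →
         Reduces (delete H v) H' → Reduces H H'
  opII : ∀ {m n} {H : Graph (suc (suc m))} {H' : Graph n} (u v w : Fin (suc (suc m))) →
         (u≢v : u ≢ v) → u ≢ w → (w≢v : w ≢ v) →
         NbhdIs₂ H v u w → NbhdIs₁ H w v →
         -- H - w - v : delete w, then delete (the renumbered) v
         Reduces (delete (delete H w) (punchOut w≢v)) H' → Reduces H H'

Dominating : ∀ {n} → Graph n → Subset n → Set
Dominating H D = ∀ v → v ∈ D ⊎ ∃ λ u → u ∈ D × Adj H u v ≡ true

DomAdj : ∀ {n} → Subset n → Subset n → Set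
DomAdj X Y = ∣ zipWith _xor_ X Y ∣ ≡ 1

HamiltonPathDom : ∀ {n} → Graph n → List (Subset n) → Set
HamiltonPathDom H P =
  All (Dominating H) P × Unique P ×
  (∀ D → Dominating H D → D ∈ₗ P) × Linked DomAdj P

HasHamiltonPathDom : ∀ {n} → Graph n → Set
HasHamiltonPathDom H = ∃ λ P → HamiltonPathDom H P

-- Each operation deletes a pendant vertex (Operation II together with its neighbour of degree two),
-- so a dominating set of H is determined by its trace on the smaller graph G and one or two bits.
-- Assigning to each dominating set of H an owner (a dominating set of G, usually its trace)
-- partitions the dominating sets of H into blocks, one for each dominating set T of G; each block
-- has one, three or five members and is a path in D(H), and the first (respectively last) members
-- of the blocks of adjacent T and T' are again adjacent. A Hamilton path T₁, …, Tₖ of D(G)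
-- therefore lifts to the Hamilton path of D(H) running through the blocks of T₁, …, Tₖ, traversed
-- alternately forwards and backwards.

module Submission where

open import Defs renaming (sym to Adj-sym)
open import Function using (_∘_; flip)
open import Data.Nat using (suc)
open import Data.Nat.Properties using (suc-injective)
open import Data.Bool using (Bool; true; false; not; _xor_)
import Data.Bool as Bool
open import Data.Bool.Properties using (¬-not; not-¬)
open import Data.Fin using (Fin; zero; suc; punchIn; punchOut; _≟_)
open import Data.Fin.Properties using (punchIn-punchOut; punchIn-injective; punchInᵢ≢i; punchOut-cong; punchOut-punchIn; all?; any?)
open import Data.Fin.Subset using (Subset; _∈_; _∉_; _⊆_; ∣_∣)
open import Data.Fin.Subset.Properties using (_∈?_)
open import Data.Vec using ([]; _∷_; lookup; zipWith; insertAt; removeAt; _[_]≔_; here; there)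
open import Data.Vec.Properties using ([]=⇒lookup; lookup⇒[]=; insertAt-lookup; insertAt-removeAt; removeAt-insertAt; []≔-updates; []≔-minimal; []≔-lookup; []≔-idempotent; []=-injective)
open import Data.Maybe using (just)
open import Data.Maybe.Relation.Binary.Connected using (Connected; just; just-nothing)
open import Data.List using (List; []; _∷_; _++_; head; last; reverse; reverseAcc)
open import Data.List.Relation.Unary.All as All using (All; []; _∷_)
open import Data.List.Relation.Unary.Any using (here; there)
import Data.List.Relation.Unary.Any.Properties as Any
open import Data.List.Relation.Unary.AllPairs using ([]; _∷_)
open import Data.List.Relation.Unary.Linked as Linked using (Linked; []; [-]; _∷_)
import Data.List.Relation.Unary.Linked.Properties as Linked
open import Data.List.Relation.Unary.Unique.Propositional using (Unique)
import Data.List.Relation.Unary.Unique.Propositional.Properties as Unique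
import Data.List.Relation.Binary.Permutation.Setoid.Properties as Permutation
open import Data.List.Relation.Binary.Permutation.Setoid using (↭-sym)
open import Data.List.Membership.Propositional using () renaming (_∈_ to _∈ₗ_)
open import Data.List.Membership.Propositional.Properties using (∈-++⁺ˡ; ∈-++⁺ʳ; ∈-++⁻)
open import Data.Product using (∃; _×_; _,_; proj₁; proj₂)
import Data.Product as Product
open import Data.Sum using (_⊎_; inj₁; inj₂)
open import Data.Empty using (⊥-elim)
open import Relation.Nullary using (¬_; Dec; yes; no)
open import Relation.Nullary.Decidable using (_×-dec_; _⊎-dec_; ¬?)
open import Relation.Binary.PropositionalEquality using (_≡_; _≢_; refl; sym; trans; cong; subst; setoid)

-- Subsets differing in exactly one element

data DiffersOnlyAt : ∀ {n} → Fin n → Subset n → Subset n → Set where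
  here  : ∀ {n x y} {X : Subset n} → x ≢ y → DiffersOnlyAt zero (x ∷ X) (y ∷ X)
  there : ∀ {n x i} {X Y : Subset n} → DiffersOnlyAt i X Y → DiffersOnlyAt (suc i) (x ∷ X) (x ∷ Y)

∣X⊕X∣≡0 : ∀ {n} (X : Subset n) → ∣ zipWith _xor_ X X ∣ ≡ 0
∣X⊕X∣≡0 []          = refl
∣X⊕X∣≡0 (true ∷ X)  = ∣X⊕X∣≡0 X
∣X⊕X∣≡0 (false ∷ X) = ∣X⊕X∣≡0 X

∣X⊕Y∣≡0⇒X≡Y : ∀ {n} (X Y : Subset n) → ∣ zipWith _xor_ X Y ∣ ≡ 0 → X ≡ Y
∣X⊕Y∣≡0⇒X≡Y []          []          _ = refl
∣X⊕Y∣≡0⇒X≡Y (true ∷ X)  (true ∷ Y)  e = cong (true ∷_) (∣X⊕Y∣≡0⇒X≡Y X Y e)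
∣X⊕Y∣≡0⇒X≡Y (false ∷ X) (false ∷ Y) e = cong (false ∷_) (∣X⊕Y∣≡0⇒X≡Y X Y e)
∣X⊕Y∣≡0⇒X≡Y (true ∷ X)  (false ∷ Y) ()
∣X⊕Y∣≡0⇒X≡Y (false ∷ X) (true ∷ Y)  ()

DiffersOnlyAt⇒DomAdj : ∀ {n i} {X Y : Subset n} → DiffersOnlyAt i X Y → DomAdj X Y
DiffersOnlyAt⇒DomAdj (here {x = true}  {false} {X} _) = cong suc (∣X⊕X∣≡0 X)
DiffersOnlyAt⇒DomAdj (here {x = false} {true}  {X} _) = cong suc (∣X⊕X∣≡0 X)
DiffersOnlyAt⇒DomAdj (here {x = true}  {true}  x≢y) = ⊥-elim (x≢y refl)
DiffersOnlyAt⇒DomAdj (here {x = false} {false} x≢y) = ⊥-elim (x≢y refl)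
DiffersOnlyAt⇒DomAdj (there {x = true}  d) = DiffersOnlyAt⇒DomAdj d
DiffersOnlyAt⇒DomAdj (there {x = false} d) = DiffersOnlyAt⇒DomAdj d

DomAdj⇒DiffersOnlyAt : ∀ {n} (X Y : Subset n) → DomAdj X Y → ∃ λ i → DiffersOnlyAt i X Y
DomAdj⇒DiffersOnlyAt [] [] ()
DomAdj⇒DiffersOnlyAt (true ∷ X) (true ∷ Y) e =
  Product.map suc there (DomAdj⇒DiffersOnlyAt X Y e)
DomAdj⇒DiffersOnlyAt (false ∷ X) (false ∷ Y) e =
  Product.map suc there (DomAdj⇒DiffersOnlyAt X Y e)
DomAdj⇒DiffersOnlyAt (true ∷ X) (false ∷ Y) e with ∣X⊕Y∣≡0⇒X≡Y X Y (suc-injective e)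
... | refl = zero , here λ ()
DomAdj⇒DiffersOnlyAt (false ∷ X) (true ∷ Y) e with ∣X⊕Y∣≡0⇒X≡Y X Y (suc-injective e)
... | refl = zero , here λ ()

DiffersOnlyAt-sym : ∀ {n i} {X Y : Subset n} → DiffersOnlyAt i X Y → DiffersOnlyAt i Y X
DiffersOnlyAt-sym (here x≢y) = here λ y≡x → x≢y (sym y≡x)
DiffersOnlyAt-sym (there d)  = there (DiffersOnlyAt-sym d)

DomAdj-sym : ∀ {n} {X Y : Subset n} → DomAdj X Y → DomAdj Y X
DomAdj-sym {X = X} {Y} adj =
  DiffersOnlyAt⇒DomAdj (DiffersOnlyAt-sym (proj₂ (DomAdj⇒DiffersOnlyAt X Y adj)))

DiffersOnlyAt-insertAt : ∀ {n i} {X Y : Subset n} (v : Fin (suc n)) b →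
  DiffersOnlyAt i X Y → DiffersOnlyAt (punchIn v i) (insertAt X v b) (insertAt Y v b)
DiffersOnlyAt-insertAt zero    b d          = there d
DiffersOnlyAt-insertAt (suc v) b (here x≢y) = here x≢y
DiffersOnlyAt-insertAt (suc v) b (there d)  = there (DiffersOnlyAt-insertAt v b d)

insertAt-DiffersOnlyAt : ∀ {n a b} (X : Subset n) v → a ≢ b →
  DiffersOnlyAt v (insertAt X v a) (insertAt X v b)
insertAt-DiffersOnlyAt X       zero    a≢b = here a≢b
insertAt-DiffersOnlyAt (x ∷ X) (suc v) a≢b = there (insertAt-DiffersOnlyAt X v a≢b)

DiffersOnlyAt-[]≔ : ∀ {n b} (X : Subset n) i → lookup X i ≢ b → DiffersOnlyAt i X (X [ i ]≔ b)
DiffersOnlyAt-[]≔ (x ∷ X) zero    x≢b = here x≢b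
DiffersOnlyAt-[]≔ (x ∷ X) (suc i) ≢b  = there (DiffersOnlyAt-[]≔ X i ≢b)

DiffersOnlyAt-[]≔-elsewhere : ∀ {n i k b} {X Y : Subset n} → i ≢ k →
  DiffersOnlyAt i X Y → DiffersOnlyAt i (X [ k ]≔ b) (Y [ k ]≔ b)
DiffersOnlyAt-[]≔-elsewhere {k = zero}  i≢k (here _)   = ⊥-elim (i≢k refl)
DiffersOnlyAt-[]≔-elsewhere {k = suc k} i≢k (here x≢y) = here x≢y
DiffersOnlyAt-[]≔-elsewhere {k = zero}  i≢k (there d)  = there d
DiffersOnlyAt-[]≔-elsewhere {k = suc k} i≢k (there d)  =
  there (DiffersOnlyAt-[]≔-elsewhere (λ i≡k → i≢k (cong suc i≡k)) d)

DiffersOnlyAt⇒∈⊎∈ : ∀ {n i} {X Y : Subset n} → DiffersOnlyAt i X Y → i ∈ X ⊎ i ∈ Y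
DiffersOnlyAt⇒∈⊎∈ (here {x = true}  _)   = inj₁ here
DiffersOnlyAt⇒∈⊎∈ (here {y = true}  _)   = inj₂ here
DiffersOnlyAt⇒∈⊎∈ (here {x = false} {false} x≢y) = ⊥-elim (x≢y refl)
DiffersOnlyAt⇒∈⊎∈ (there d) with DiffersOnlyAt⇒∈⊎∈ d
... | inj₁ i∈X = inj₁ (there i∈X)
... | inj₂ i∈Y = inj₂ (there i∈Y)

DiffersOnlyAt⇒[]≔true : ∀ {n i j} {X Y : Subset n} → DiffersOnlyAt i X Y → j ∈ X → j ∉ Y →
  X ≡ Y [ j ]≔ true
DiffersOnlyAt⇒[]≔true (here _)  here        _   = refl
DiffersOnlyAt⇒[]≔true (here _)  (there j∈X) j∉Y = ⊥-elim (j∉Y (there j∈X))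
DiffersOnlyAt⇒[]≔true (there _) here        j∉Y = ⊥-elim (j∉Y here)
DiffersOnlyAt⇒[]≔true (there d) (there j∈X) j∉Y =
  cong (_ ∷_) (DiffersOnlyAt⇒[]≔true d j∈X λ j∈Y → j∉Y (there j∈Y))

⊆-[]≔true : ∀ {n} (D : Subset n) i → D ⊆ D [ i ]≔ true
⊆-[]≔true D i {j} j∈D with j ≟ i
... | yes refl = []≔-updates D i
... | no j≢i   = []≔-minimal D j i j≢i j∈D

∉⇒[]≔false : ∀ {n} {D : Subset n} {i} → i ∉ D → D [ i ]≔ false ≡ D
∉⇒[]≔false {D = D} {i} i∉D =
  trans (cong (D [ i ]≔_) (sym (¬-not (λ eq → i∉D (lookup⇒[]= i D eq))))) ([]≔-lookup D i)

∈⇒[]≔true : ∀ {n} {D : Subset n} {i} → i ∈ D → D [ i ]≔ true ≡ D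
∈⇒[]≔true {D = D} {i} i∈D = trans (cong (D [ i ]≔_) (sym ([]=⇒lookup i∈D))) ([]≔-lookup D i)

∉⇒[]≔true[]≔false : ∀ {n} {D : Subset n} {i} → i ∉ D → D [ i ]≔ true [ i ]≔ false ≡ D
∉⇒[]≔true[]≔false {D = D} {i} i∉D = trans ([]≔-idempotent D i) (∉⇒[]≔false i∉D)

∈⇒[]≔false[]≔true : ∀ {n} {D : Subset n} {i} → i ∈ D → D [ i ]≔ false [ i ]≔ true ≡ D
∈⇒[]≔false[]≔true {D = D} {i} i∈D = trans ([]≔-idempotent D i) (∈⇒[]≔true i∈D)

∉-[]≔false : ∀ {n} (D : Subset n) i → i ∉ D [ i ]≔ false
∉-[]≔false D i i∈ with []=-injective i∈ ([]≔-updates D i)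
... | ()

data Punched {n} (v : Fin (suc n)) : Fin (suc n) → Set where
  pivot   : Punched v v
  punched : ∀ j → Punched v (punchIn v j)

punched? : ∀ {n} (v z : Fin (suc n)) → Punched v z
punched? v z with v ≟ z
... | yes refl = pivot
... | no v≢z   = subst (Punched v) (punchIn-punchOut v≢z) (punched _)

∈-insertAt⁺ : ∀ {n} {T : Subset n} v b {j} → j ∈ T → punchIn v j ∈ insertAt T v b
∈-insertAt⁺ zero    b j∈T         = there j∈T
∈-insertAt⁺ (suc v) b here        = here
∈-insertAt⁺ (suc v) b (there j∈T) = there (∈-insertAt⁺ v b j∈T)

∈-insertAt⁻ : ∀ {n} {T : Subset n} v b {j} → punchIn v j ∈ insertAt T v b → j ∈ T
∈-insertAt⁻                     zero    b         (there j∈T) = j∈T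
∈-insertAt⁻ {T = _ ∷ _} (suc v) b {zero}  here        = here
∈-insertAt⁻ {T = _ ∷ _} (suc v) b {suc j} (there j∈T) = there (∈-insertAt⁻ v b j∈T)

pivot-∈-insertAt : ∀ {n} (T : Subset n) v → v ∈ insertAt T v true
pivot-∈-insertAt T v = lookup⇒[]= v _ (insertAt-lookup T v true)

pivot-∈-insertAt⁻ : ∀ {n} {T : Subset n} v {b} → v ∈ insertAt T v b → b ≡ true
pivot-∈-insertAt⁻ {T = T} v {b} v∈ = trans (sym (insertAt-lookup T v b)) ([]=⇒lookup v∈)

data Extension {n} (v : Fin (suc n)) : Subset (suc n) → Set where
  extension : ∀ T b → Extension v (insertAt T v b)

extension? : ∀ {n} (v : Fin (suc n)) S → Extension v S
extension? v S = subst (Extension v) (insertAt-removeAt S v) (extension _ _)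

insertAt-injective : ∀ {n} {X Y : Subset n} v {a b} → insertAt X v a ≡ insertAt Y v b → X ≡ Y × a ≡ b
insertAt-injective {X = X} {Y} v {a} {b} eq =
  trans (sym (removeAt-insertAt X v a)) (trans (cong (λ S → removeAt S v) eq) (removeAt-insertAt Y v b)) ,
  trans (sym (insertAt-lookup X v a)) (trans (cong (λ S → lookup S v) eq) (insertAt-lookup Y v b))

Dominates : ∀ {n} → Graph n → Subset n → Fin n → Set
Dominates H D z = z ∈ D ⊎ ∃ λ y → y ∈ D × Adj H y z ≡ true

dominates? : ∀ {n} (H : Graph n) D z → Dec (Dominates H D z)
dominates? H D z = (z ∈? D) ⊎-dec any? λ y → (y ∈? D) ×-dec (Adj H y z Bool.≟ true)

dominating? : ∀ {n} (H : Graph n) D → Dec (Dominating H D)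
dominating? H D = all? (dominates? H D)

Dominates-mono : ∀ {n} (H : Graph n) {D D' z} → D ⊆ D' → Dominates H D z → Dominates H D' z
Dominates-mono H D⊆D' (inj₁ z∈D)           = inj₁ (D⊆D' z∈D)
Dominates-mono H D⊆D' (inj₂ (y , y∈D , a)) = inj₂ (y , D⊆D' y∈D , a)

Dominating-mono : ∀ {n} (H : Graph n) {D D'} → D ⊆ D' → Dominating H D → Dominating H D'
Dominating-mono H D⊆D' dD z = Dominates-mono H D⊆D' (dD z)

Dominating-remove : ∀ {n} (H : Graph n) {D y} → Dominating H D → (∀ {z} → Adj H y z ≡ true → z ∈ D) →
  Dominates H (D [ y ]≔ false) y → Dominating H (D [ y ]≔ false)
Dominating-remove H {D} {y} dD N⊆D dy z with z ≟ y
... | yes refl = dy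
... | no z≢y with dD z
...   | inj₁ z∈D = inj₁ ([]≔-minimal D z y z≢y z∈D)
...   | inj₂ (k , k∈D , a) with k ≟ y
...     | yes refl = inj₁ ([]≔-minimal D z y z≢y (N⊆D a))
...     | no k≢y   = inj₂ (k , []≔-minimal D k y k≢y k∈D , a)

NbhdIs₁-adj : ∀ {n} (H : Graph n) {y x} → NbhdIs₁ H y x → Adj H y x ≡ true
NbhdIs₁-adj H {y} {x} N = proj₂ (N x) refl

NbhdIs₁-adj-sym : ∀ {n} (H : Graph n) {y x} → NbhdIs₁ H y x → Adj H x y ≡ true
NbhdIs₁-adj-sym H {y} {x} N = trans (Adj-sym H x y) (NbhdIs₁-adj H N)

NbhdIs₁-only : ∀ {n} (H : Graph n) {y x z} → NbhdIs₁ H y x → Adj H z y ≡ true → z ≡ x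
NbhdIs₁-only H {y} {z = z} N a = proj₁ (N z) (trans (Adj-sym H y z) a)

leaf-dominated : ∀ {n} (H : Graph n) {y x D} → NbhdIs₁ H y x → Dominates H D y → y ∈ D ⊎ x ∈ D
leaf-dominated H N (inj₁ y∈D)           = inj₁ y∈D
leaf-dominated H N (inj₂ (k , k∈D , a)) = inj₂ (subst (_∈ _) (NbhdIs₁-only H N a) k∈D)

NbhdIs₁-delete : ∀ {n} (H : Graph (suc n)) {v y x} →
  NbhdIs₁ H (punchIn v y) (punchIn v x) → NbhdIs₁ (delete H v) y x
NbhdIs₁-delete H {v} N z =
  (λ a → punchIn-injective v _ _ (proj₁ (N (punchIn v z)) a)) , λ { refl → proj₂ (N _) refl }

module _ {n} (H : Graph (suc n)) (v : Fin (suc n)) where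

  Dominates-insertAt⁺ : ∀ {T j} b → Dominates (delete H v) T j → Dominates H (insertAt T v b) (punchIn v j)
  Dominates-insertAt⁺ b (inj₁ j∈T)           = inj₁ (∈-insertAt⁺ v b j∈T)
  Dominates-insertAt⁺ b (inj₂ (k , k∈T , a)) = inj₂ (punchIn v k , ∈-insertAt⁺ v b k∈T , a)

  Dominates-insertAt⁻ : ∀ {T j} b → Dominates H (insertAt T v b) (punchIn v j) →
    Dominates (delete H v) T j ⊎ (b ≡ true × Adj H v (punchIn v j) ≡ true)
  Dominates-insertAt⁻ b (inj₁ j∈S) = inj₁ (inj₁ (∈-insertAt⁻ v b j∈S))
  Dominates-insertAt⁻ b (inj₂ (k , k∈S , a)) with punched? v k
  ... | pivot      = inj₂ (pivot-∈-insertAt⁻ v k∈S , a)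
  ... | punched k' = inj₁ (inj₂ (k' , ∈-insertAt⁻ v b k∈S , a))

  Dominating-insertAt : ∀ {T} b → Dominating (delete H v) T →
    Dominates H (insertAt T v b) v → Dominating H (insertAt T v b)
  Dominating-insertAt b dT dv z with punched? v z
  ... | pivot     = dv
  ... | punched j = Dominates-insertAt⁺ b (dT j)

-- Lifting Hamilton paths through a block decomposition

Linked-reverseAcc : ∀ {A : Set} {R : A → A → Set} {x acc xs} →
  Linked R (x ∷ acc) → Linked (flip R) (x ∷ xs) → Linked R (reverseAcc (x ∷ acc) xs)
Linked-reverseAcc acc [-]        = acc
Linked-reverseAcc acc (r ∷ rxs)  = Linked-reverseAcc (r ∷ acc) rxs

Linked-reverse : ∀ {A : Set} {R : A → A → Set} {xs} → Linked (flip R) xs → Linked R (reverse xs)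
Linked-reverse {xs = []}    _ = []
Linked-reverse {xs = _ ∷ _} l = Linked-reverseAcc [-] l

Unique-reverse : ∀ {A : Set} {xs : List A} → Unique xs → Unique (reverse xs)
Unique-reverse {A} {xs} =
  Permutation.Unique-resp-↭ (setoid A) (↭-sym (setoid A) (Permutation.↭-reverse (setoid A) xs))

last-reverseAcc : ∀ {A : Set} (a : A) as xs → last (reverseAcc (a ∷ as) xs) ≡ last (a ∷ as)
last-reverseAcc a as []       = refl
last-reverseAcc a as (x ∷ xs) = last-reverseAcc x (a ∷ as) xs

head-reverseAcc : ∀ {A : Set} (acc : List A) x xs → head (reverseAcc acc (x ∷ xs)) ≡ last (x ∷ xs)
head-reverseAcc acc x []       = refl
head-reverseAcc acc x (y ∷ xs) = head-reverseAcc (x ∷ acc) y xs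

head-reverse : ∀ {A : Set} (xs : List A) → head (reverse xs) ≡ last xs
head-reverse []       = refl
head-reverse (x ∷ xs) = head-reverseAcc [] x xs

last-reverse : ∀ {A : Set} (xs : List A) → last (reverse xs) ≡ head xs
last-reverse []       = refl
last-reverse (x ∷ xs) = last-reverseAcc x [] xs

record BlockDecomposition {n N} (G : Graph n) (H : Graph N) : Set where
  field
    block            : Subset n → List (Subset N)
    source target    : Subset n → Subset N
    head-block       : ∀ T → head (block T) ≡ just (source T)
    last-block       : ∀ T → last (block T) ≡ just (target T)
    block-path       : ∀ T → Linked DomAdj (block T)
    block-unique     : ∀ T → Unique (block T)
    source-adj       : ∀ {T T'} → DomAdj T T' → DomAdj (source T) (source T')
    target-adj       : ∀ {T T'} → DomAdj T T' → DomAdj (target T) (target T')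
    block-dominating : ∀ {T} → Dominating G T → All (Dominating H) (block T)
    owner            : Subset N → Subset n
    owner-block      : ∀ {T S} → Dominating G T → S ∈ₗ block T → owner S ≡ T
    owner-dominating : ∀ {S} → Dominating H S → Dominating G (owner S)
    ∈-block-owner    : ∀ {S} → Dominating H S → S ∈ₗ block (owner S)

  oriented : Bool → Subset n → List (Subset N)
  oriented true  T = block T
  oriented false T = reverse (block T)

  entry : Bool → Subset n → Subset N
  entry true  = source
  entry false = target

  head-oriented : ∀ b T → head (oriented b T) ≡ just (entry b T)
  head-oriented true  T = head-block T
  head-oriented false T = trans (head-reverse (block T)) (last-block T)

  last-oriented : ∀ b T → last (oriented b T) ≡ just (entry (not b) T)
  last-oriented true  T = last-block T
  last-oriented false T = trans (last-reverse (block T)) (head-block T)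

  entry-adj : ∀ b {T T'} → DomAdj T T' → DomAdj (entry b T) (entry b T')
  entry-adj true  = source-adj
  entry-adj false = target-adj

  oriented-path : ∀ b T → Linked DomAdj (oriented b T)
  oriented-path true  T = block-path T
  oriented-path false T =
    Linked-reverse (Linked.map (λ {X Y} → DomAdj-sym {X = X} {Y}) (block-path T))

  oriented-unique : ∀ b T → Unique (oriented b T)
  oriented-unique true  T = block-unique T
  oriented-unique false T = Unique-reverse (block-unique T)

  ∈-oriented⁺ : ∀ b {T S} → S ∈ₗ block T → S ∈ₗ oriented b T
  ∈-oriented⁺ true  S∈ = S∈
  ∈-oriented⁺ false S∈ = Any.reverse⁺ S∈

  ∈-oriented⁻ : ∀ b {T S} → S ∈ₗ oriented b T → S ∈ₗ block T
  ∈-oriented⁻ true  S∈ = S∈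
  ∈-oriented⁻ false S∈ = Any.reverse⁻ S∈

  snake : Bool → List (Subset n) → List (Subset N)
  snake b []       = []
  snake b (T ∷ Ts) = oriented b T ++ snake (not b) Ts

  head-snake : ∀ b T Ts → head (snake b (T ∷ Ts)) ≡ just (entry b T)
  head-snake b T Ts with oriented b T | head-oriented b T
  ... | _ ∷ _ | eq = eq

  snake-path : ∀ b {Ts} → Linked DomAdj Ts → Linked DomAdj (snake b Ts)
  snake-path b {[]}     _ = []
  snake-path b {T ∷ Ts} l =
    Linked.++⁺ (oriented-path b T) (junction Ts l) (snake-path (not b) (Linked.tail l))
    where
    junction : ∀ Ts → Linked DomAdj (T ∷ Ts) →
      Connected DomAdj (last (oriented b T)) (head (snake (not b) Ts))
    junction []        _       rewrite last-oriented b T = just-nothing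
    junction (T' ∷ Ts) (a ∷ _) rewrite last-oriented b T | head-snake (not b) T' Ts =
      just (entry-adj (not b) a)

  ∈-snake⁺ : ∀ b {Ts T S} → T ∈ₗ Ts → S ∈ₗ block T → S ∈ₗ snake b Ts
  ∈-snake⁺ b {T ∷ Ts} (here refl) S∈ = ∈-++⁺ˡ (∈-oriented⁺ b S∈)
  ∈-snake⁺ b {T ∷ Ts} (there T∈) S∈  = ∈-++⁺ʳ (oriented b T) (∈-snake⁺ (not b) T∈ S∈)

  ∈-snake⁻ : ∀ b {Ts S} → S ∈ₗ snake b Ts → ∃ λ T → T ∈ₗ Ts × S ∈ₗ block T
  ∈-snake⁻ b {T ∷ Ts} S∈ with ∈-++⁻ (oriented b T) S∈
  ... | inj₁ S∈T  = T , here refl , ∈-oriented⁻ b S∈T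
  ... | inj₂ S∈Ts = let T' , T'∈ , S∈T' = ∈-snake⁻ (not b) S∈Ts in T' , there T'∈ , S∈T'

  snake-dominating : ∀ b {Ts} → All (Dominating G) Ts → All (Dominating H) (snake b Ts)
  snake-dominating b dTs = All.tabulate λ S∈ →
    let T , T∈ , S∈T = ∈-snake⁻ b S∈ in All.lookup (block-dominating (All.lookup dTs T∈)) S∈T

  snake-unique : ∀ b {Ts} → All (Dominating G) Ts → Unique Ts → Unique (snake b Ts)
  snake-unique b {[]}     _          _            = []
  snake-unique b {T ∷ Ts} (dT ∷ dTs) (T∉Ts ∷ uTs) =
    Unique.++⁺ (oriented-unique b T) (snake-unique (not b) dTs uTs) λ (S∈T , S∈Ts) →
      let T' , T'∈ , S∈T' = ∈-snake⁻ (not b) S∈Ts in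
      All.lookup T∉Ts T'∈
        (trans (sym (owner-block dT (∈-oriented⁻ b S∈T))) (owner-block (All.lookup dTs T'∈) S∈T'))

  lift-hamiltonPath : HasHamiltonPathDom G → HasHamiltonPathDom H
  lift-hamiltonPath (P , dP , uP , complete , path) =
    snake true P , snake-dominating true dP , snake-unique true dP uP ,
    (λ S dS → ∈-snake⁺ true (complete (owner S) (owner-dominating dS)) (∈-block-owner dS)) ,
    snake-path true path

-- Operation I

module OperationI {m} (H : Graph (suc m)) (v : Fin (suc m)) {u x : Fin m} (u≢x : u ≢ x)
  (N-u : NbhdIs₁ H (punchIn v u) (punchIn v x)) (N-v : NbhdIs₁ H v (punchIn v x)) where

  G : Graph m
  G = delete H v

  extend : Subset m → Bool → Subset (suc m)
  extend T b = insertAt T v b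

  -- For u ∉ T the block T + v, T, T + u is a path; for u ∈ T only T + v remains, because T
  -- (as a set avoiding v) already lies in the block of T - u.
  block : Subset m → List (Subset (suc m))
  block T with u ∈? T
  ... | yes _ = extend T true ∷ []
  ... | no _  = extend T true ∷ extend T false ∷ extend (T [ u ]≔ true) false ∷ []

  target : Subset m → Subset (suc m)
  target T with u ∈? T
  ... | yes _ = extend T true
  ... | no _  = extend (T [ u ]≔ true) false

  retract : Subset m → Bool → Subset m
  retract T true  = T
  retract T false = T [ u ]≔ false

  owner : Subset (suc m) → Subset m
  owner S = retract (removeAt S v) (lookup S v)

  owner-extend : ∀ T b → owner (extend T b) ≡ retract T b
  owner-extend T b rewrite removeAt-insertAt T v b | insertAt-lookup T v b = refl

  flip-v : ∀ T → DomAdj (extend T true) (extend T false)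
  flip-v T = DiffersOnlyAt⇒DomAdj (insertAt-DiffersOnlyAt T v λ ())

  extend-adj : ∀ {i T T'} b → DiffersOnlyAt i T T' → DomAdj (extend T b) (extend T' b)
  extend-adj b d = DiffersOnlyAt⇒DomAdj (DiffersOnlyAt-insertAt v b d)

  add-u : ∀ {T} → u ∉ T → DomAdj (extend T false) (extend (T [ u ]≔ true) false)
  add-u {T} u∉T = extend-adj false (DiffersOnlyAt-[]≔ T u λ eq → u∉T (lookup⇒[]= u T eq))

  extend-true≢false : ∀ {T T'} → extend T true ≢ extend T' false
  extend-true≢false eq with proj₂ (insertAt-injective v eq)
  ... | ()

  target-adj-∈∉ : ∀ {i T T'} → DiffersOnlyAt i T T' → u ∈ T → u ∉ T' →
    DomAdj (extend T true) (extend (T' [ u ]≔ true) false)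
  target-adj-∈∉ {T' = T'} d u∈T u∉T' rewrite DiffersOnlyAt⇒[]≔true d u∈T u∉T' = flip-v (T' [ u ]≔ true)

  target-adj : ∀ {T T'} → DomAdj T T' → DomAdj (target T) (target T')
  target-adj {T} {T'} adj with DomAdj⇒DiffersOnlyAt T T' adj
  ... | i , d with u ∈? T | u ∈? T'
  ...   | yes _   | yes _   = extend-adj true d
  ...   | yes u∈T | no u∉T' = target-adj-∈∉ d u∈T u∉T'
  ...   | no u∉T  | yes u∈T' =
    DomAdj-sym {X = extend T' true} (target-adj-∈∉ (DiffersOnlyAt-sym d) u∈T' u∉T)
  ...   | no u∉T  | no u∉T' = extend-adj false (DiffersOnlyAt-[]≔-elsewhere i≢u d)
    where
    i≢u : i ≢ u
    i≢u refl with DiffersOnlyAt⇒∈⊎∈ d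
    ... | inj₁ u∈T  = u∉T u∈T
    ... | inj₂ u∈T' = u∉T' u∈T'

  N-uG : NbhdIs₁ G u x
  N-uG = NbhdIs₁-delete H N-u

  u∉⇒x∈ : ∀ {T} → Dominating G T → u ∉ T → x ∈ T
  u∉⇒x∈ dT u∉T with leaf-dominated G N-uG (dT u)
  ... | inj₁ u∈T = ⊥-elim (u∉T u∈T)
  ... | inj₂ x∈T = x∈T

  extend-true-dominating : ∀ {T} → Dominating G T → Dominating H (extend T true)
  extend-true-dominating {T} dT = Dominating-insertAt H v true dT (inj₁ (pivot-∈-insertAt T v))

  extend-false-dominating : ∀ {T} → Dominating G T → x ∈ T → Dominating H (extend T false)
  extend-false-dominating dT x∈T =
    Dominating-insertAt H v false dT (inj₂ (punchIn v x , ∈-insertAt⁺ v false x∈T , NbhdIs₁-adj-sym H N-v))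

  block-dominating : ∀ {T} → Dominating G T → All (Dominating H) (block T)
  block-dominating {T} dT with u ∈? T
  ... | yes _   = extend-true-dominating dT ∷ []
  ... | no u∉T  = extend-true-dominating dT ∷ extend-false-dominating dT x∈T ∷
                  extend-false-dominating (Dominating-mono G (⊆-[]≔true T u) dT) (⊆-[]≔true T u x∈T) ∷ []
    where
    x∈T = u∉⇒x∈ dT u∉T

  restriction-dominating : ∀ {T b} → Dominating H (extend T b) → Dominating G T
  restriction-dominating {T} {b} dS j with Dominates-insertAt⁻ H v b (dS (punchIn v j))
  ... | inj₁ dj = dj
  ... | inj₂ (_ , a) with punchIn-injective v j x (proj₁ (N-v (punchIn v j)) a)
  ...   | refl with leaf-dominated H N-u (dS (punchIn v u))
  ...     | inj₁ ū∈S = inj₂ (u , ∈-insertAt⁻ v b ū∈S , NbhdIs₁-adj H N-u)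
  ...     | inj₂ x̄∈S = inj₁ (∈-insertAt⁻ v b x̄∈S)

  v∉⇒x∈ : ∀ {T} → Dominating H (extend T false) → x ∈ T
  v∉⇒x∈ dS with leaf-dominated H N-v (dS v)
  ... | inj₂ x̄∈S = ∈-insertAt⁻ v false x̄∈S
  ... | inj₁ v∈S with pivot-∈-insertAt⁻ v v∈S
  ...   | ()

  retract-dominating : ∀ T b → Dominating H (extend T b) → Dominating G (retract T b)
  retract-dominating T true  dS = restriction-dominating dS
  retract-dominating T false dS =
    Dominating-remove G (restriction-dominating dS)
      (λ a → subst (_∈ T) (sym (proj₁ (N-uG _) a)) x∈T)
      (inj₂ (x , []≔-minimal T x u (λ x≡u → u≢x (sym x≡u)) x∈T , NbhdIs₁-adj-sym G N-uG))
    where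
    x∈T = v∉⇒x∈ dS

  owner-dominating : ∀ {S} → Dominating H S → Dominating G (owner S)
  owner-dominating {S} dS with extension? v S
  ... | extension T b rewrite owner-extend T b = retract-dominating T b dS

  extend-∈-block-retract : ∀ T b → extend T b ∈ₗ block (retract T b)
  extend-∈-block-retract T true with u ∈? T
  ... | yes _ = here refl
  ... | no _  = here refl
  extend-∈-block-retract T false with u ∈? (T [ u ]≔ false) | u ∈? T
  ... | yes u∈ | _      = ⊥-elim (∉-[]≔false T u u∈)
  ... | no _   | no u∉T = there (here (cong (λ T' → extend T' false) (sym (∉⇒[]≔false u∉T))))
  ... | no _   | yes u∈T = there (there (here (cong (λ T' → extend T' false)
          (sym (∈⇒[]≔false[]≔true u∈T)))))

  ∈-block-owner : ∀ {S} → Dominating H S → S ∈ₗ block (owner S)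
  ∈-block-owner {S} _ with extension? v S
  ... | extension T b rewrite owner-extend T b = extend-∈-block-retract T b

  owner-block : ∀ {T S} → S ∈ₗ block T → owner S ≡ T
  owner-block {T} S∈ with u ∈? T
  owner-block {T} (here refl)                 | yes _  = owner-extend T true
  owner-block {T} (here refl)                 | no _   = owner-extend T true
  owner-block {T} (there (here refl))         | no u∉T = trans (owner-extend T false) (∉⇒[]≔false u∉T)
  owner-block {T} (there (there (here refl))) | no u∉T =
    trans (owner-extend (T [ u ]≔ true) false) (∉⇒[]≔true[]≔false u∉T)

  block-unique : ∀ T → Unique (block T)
  block-unique T with u ∈? T
  ... | yes _  = [] ∷ []
  ... | no u∉T = (extend-true≢false ∷ extend-true≢false ∷ []) ∷ (absent≢added ∷ []) ∷ [] ∷ []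
    where
    absent≢added : extend T false ≢ extend (T [ u ]≔ true) false
    absent≢added eq = u∉T (subst (u ∈_) (sym (proj₁ (insertAt-injective v eq))) ([]≔-updates T u))

  block-path : ∀ T → Linked DomAdj (block T)
  block-path T with u ∈? T
  ... | yes _  = [-]
  ... | no u∉T = flip-v T ∷ add-u u∉T ∷ [-]

  decomposition : BlockDecomposition G H
  decomposition = record
    { block            = block
    ; source           = λ T → extend T true
    ; target           = target
    ; head-block       = head-block
    ; last-block       = last-block
    ; block-path       = block-path
    ; block-unique     = block-unique
    ; source-adj       = λ {T} {T'} adj → extend-adj true (proj₂ (DomAdj⇒DiffersOnlyAt T T' adj))
    ; target-adj       = target-adj
    ; block-dominating = block-dominating
    ; owner            = owner
    ; owner-block      = λ _ → owner-block
    ; owner-dominating = owner-dominating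
    ; ∈-block-owner    = ∈-block-owner
    }
    where
    head-block : ∀ T → head (block T) ≡ just (extend T true)
    head-block T with u ∈? T
    ... | yes _ = refl
    ... | no _  = refl
    last-block : ∀ T → last (block T) ≡ just (target T)
    last-block T with u ∈? T
    ... | yes _ = refl
    ... | no _  = refl

-- Operation II

module OperationII {m} (H : Graph (suc (suc m))) (w : Fin (suc (suc m))) (v : Fin (suc m)) {u : Fin m}
  (N-v : NbhdIs₂ H (punchIn w v) (punchIn w (punchIn v u)) w) (N-w : NbhdIs₁ H w (punchIn w v)) where

  G : Graph m
  G = delete (delete H w) v

  extend : Subset m → Bool → Bool → Subset (suc (suc m))
  extend T a b = insertAt (insertAt T v a) w b

  AlmostDominating : Subset m → Set
  AlmostDominating T = ∀ j → j ≢ u → Dominates G T j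

  Dominates-extend⁺ : ∀ {T j} a b → Dominates G T j → Dominates H (extend T a b) (punchIn w (punchIn v j))
  Dominates-extend⁺ a b d = Dominates-insertAt⁺ H w b (Dominates-insertAt⁺ (delete H w) v a d)

  Dominates-extend⁻ : ∀ {T j} a b → Dominates H (extend T a b) (punchIn w (punchIn v j)) →
    Dominates G T j ⊎ (a ≡ true × j ≡ u)
  Dominates-extend⁻ {j = j} a b d with Dominates-insertAt⁻ H w b d
  ... | inj₂ (_ , adj) = ⊥-elim (punchInᵢ≢i v j (punchIn-injective w _ _ (proj₁ (N-w _) adj)))
  ... | inj₁ d' with Dominates-insertAt⁻ (delete H w) v a d'
  ...   | inj₁ dj = inj₁ dj
  ...   | inj₂ (a≡true , adj) with proj₁ (N-v _) adj
  ...     | inj₁ ιj≡ιu = inj₂ (a≡true , punchIn-injective v _ _ (punchIn-injective w _ _ ιj≡ιu))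
  ...     | inj₂ ιj≡w  = ⊥-elim (punchInᵢ≢i w _ ιj≡w)

  Dominating⇒AlmostDominating : ∀ {T} → Dominating G T → AlmostDominating T
  Dominating⇒AlmostDominating dT j _ = dT j

  restriction-almostDominating : ∀ {T a b} → Dominating H (extend T a b) → AlmostDominating T
  restriction-almostDominating {a = a} {b} dS j j≢u with Dominates-extend⁻ a b (dS _)
  ... | inj₁ dj = dj
  ... | inj₂ (_ , j≡u) = ⊥-elim (j≢u j≡u)

  restriction-dominating : ∀ {T b} → Dominating H (extend T false b) → Dominating G T
  restriction-dominating {b = b} dS j with Dominates-extend⁻ false b (dS _)
  ... | inj₁ dj = dj
  ... | inj₂ (() , _)

  AlmostDominating-∈ : ∀ {T} → AlmostDominating T → u ∈ T → Dominating G T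
  AlmostDominating-∈ dT u∈T j with j ≟ u
  ... | yes refl = inj₁ u∈T
  ... | no j≢u   = dT j j≢u

  Dominating-extend : ∀ {T a b} → AlmostDominating T →
    Dominates H (extend T a b) (punchIn w (punchIn v u)) → Dominates H (extend T a b) (punchIn w v) →
    Dominates H (extend T a b) w → Dominating H (extend T a b)
  Dominating-extend {a = a} {b} dT dū dv̄ dw z with punched? w z
  ... | pivot = dw
  ... | punched z' with punched? v z'
  ...   | pivot = dv̄
  ...   | punched j with j ≟ u
  ...     | yes refl = dū
  ...     | no j≢u   = Dominates-extend⁺ a b (dT j j≢u)

  v̄∈extend-true : ∀ T b → punchIn w v ∈ extend T true b
  v̄∈extend-true T b = ∈-insertAt⁺ w b (pivot-∈-insertAt T v)

  extend-true-dominating : ∀ {T} b → AlmostDominating T → Dominating H (extend T true b)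
  extend-true-dominating {T} b dT = Dominating-extend dT
    (inj₂ (punchIn w v , v̄∈extend-true T b , proj₂ (N-v _) (inj₁ refl)))
    (inj₁ (v̄∈extend-true T b))
    (inj₂ (punchIn w v , v̄∈extend-true T b , proj₂ (N-v w) (inj₂ refl)))

  extend-false-true-dominating : ∀ {T} → Dominating G T → Dominating H (extend T false true)
  extend-false-true-dominating {T} dT = Dominating-extend (Dominating⇒AlmostDominating dT)
    (Dominates-extend⁺ false true (dT u))
    (inj₂ (w , pivot-∈-insertAt _ w , NbhdIs₁-adj H N-w))
    (inj₁ (pivot-∈-insertAt _ w))

  extend-false-dominating⇒true : ∀ {T b} → Dominating H (extend T false b) → b ≡ true
  extend-false-dominating⇒true dS with leaf-dominated H N-w (dS w)
  ... | inj₁ w∈S = pivot-∈-insertAt⁻ w w∈S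
  ... | inj₂ v̄∈S with pivot-∈-insertAt⁻ v (∈-insertAt⁻ w _ v̄∈S)
  ...   | ()

  -- The trace of a dominating set of H containing v dominates G except possibly at u, which v
  -- dominates in H; a trace missing u is completed by adding u.
  completion : Subset m → Subset m
  completion T with dominating? G T
  ... | yes _ = T
  ... | no _  = T [ u ]≔ true

  completion-dominating : ∀ {T} → AlmostDominating T → Dominating G (completion T)
  completion-dominating {T} dT with dominating? G T
  ... | yes dT' = dT'
  ... | no _    =
    AlmostDominating-∈ (λ j j≢u → Dominates-mono G (⊆-[]≔true T u) (dT j j≢u)) ([]≔-updates T u)

  owner : Subset (suc (suc m)) → Subset m
  owner S = completion (removeAt (removeAt S w) v)

  owner-extend : ∀ T a b → owner (extend T a b) ≡ completion T
  owner-extend T a b rewrite removeAt-insertAt (insertAt T v a) w b | removeAt-insertAt T v a = refl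

  LongBlock : Subset m → Set
  LongBlock T = u ∈ T × ¬ Dominating G (T [ u ]≔ false) × Dominating H (extend (T [ u ]≔ false) true false)

  longBlock? : ∀ T → Dec (LongBlock T)
  longBlock? T = (u ∈? T) ×-dec ¬? (dominating? G _) ×-dec dominating? H _

  block : Subset m → List (Subset (suc (suc m)))
  block T with longBlock? T
  ... | no _  = extend T false true ∷ extend T true true ∷ extend T true false ∷ []
  ... | yes _ = extend T false true ∷ extend T true true ∷
                extend (T [ u ]≔ false) true true ∷ extend (T [ u ]≔ false) true false ∷
                extend T true false ∷ []

  flip-v : ∀ T b → DomAdj (extend T false b) (extend T true b)
  flip-v T b = DiffersOnlyAt⇒DomAdj (DiffersOnlyAt-insertAt w b (insertAt-DiffersOnlyAt T v λ ()))

  flip-w : ∀ T a → DomAdj (extend T a true) (extend T a false)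
  flip-w T a = DiffersOnlyAt⇒DomAdj (insertAt-DiffersOnlyAt (insertAt T v a) w λ ())

  extend-adj : ∀ {i T T'} a b → DiffersOnlyAt i T T' → DomAdj (extend T a b) (extend T' a b)
  extend-adj a b d = DiffersOnlyAt⇒DomAdj (DiffersOnlyAt-insertAt w b (DiffersOnlyAt-insertAt v a d))

  remove-u : ∀ {T} → u ∈ T → DiffersOnlyAt u T (T [ u ]≔ false)
  remove-u {T} u∈T = DiffersOnlyAt-[]≔ T u (not-¬ ([]=⇒lookup u∈T))

  extend-injective : ∀ {T T' a a' b b'} → extend T a b ≡ extend T' a' b' → T ≡ T' × a ≡ a' × b ≡ b'
  extend-injective eq =
    let eq₁ , b≡b' = insertAt-injective w eq
        T≡T' , a≡a' = insertAt-injective v eq₁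
    in T≡T' , a≡a' , b≡b'

  ≢-subset : ∀ {T T' a a' b b'} → T ≢ T' → extend T a b ≢ extend T' a' b'
  ≢-subset T≢T' eq = T≢T' (proj₁ (extend-injective eq))

  ≢-v : ∀ {T T' a a' b b'} → a ≢ a' → extend T a b ≢ extend T' a' b'
  ≢-v a≢a' eq = a≢a' (proj₁ (proj₂ (extend-injective eq)))

  ≢-w : ∀ {T T' a a' b b'} → b ≢ b' → extend T a b ≢ extend T' a' b'
  ≢-w b≢b' eq = b≢b' (proj₂ (proj₂ (extend-injective eq)))

  block-unique : ∀ T → Unique (block T)
  block-unique T with longBlock? T
  ... | no _ = (≢-v (λ ()) ∷ ≢-v (λ ()) ∷ []) ∷ (≢-w (λ ()) ∷ []) ∷ [] ∷ []
  ... | yes (u∈T , _) =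
    (≢-v (λ ()) ∷ ≢-v (λ ()) ∷ ≢-v (λ ()) ∷ ≢-v (λ ()) ∷ []) ∷
    (≢-subset T≢T⁻ ∷ ≢-w (λ ()) ∷ ≢-w (λ ()) ∷ []) ∷
    (≢-w (λ ()) ∷ ≢-w (λ ()) ∷ []) ∷
    (≢-subset (λ eq → T≢T⁻ (sym eq)) ∷ []) ∷ [] ∷ []
    where
    T≢T⁻ : T ≢ T [ u ]≔ false
    T≢T⁻ eq = ∉-[]≔false T u (subst (u ∈_) eq u∈T)

  block-path : ∀ T → Linked DomAdj (block T)
  block-path T with longBlock? T
  ... | no _ = flip-v T true ∷ flip-w T true ∷ [-]
  ... | yes (u∈T , _) =
    flip-v T true ∷ extend-adj true true (remove-u u∈T) ∷ flip-w _ true ∷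
    extend-adj true false (DiffersOnlyAt-sym (remove-u u∈T)) ∷ [-]

  block-dominating : ∀ {T} → Dominating G T → All (Dominating H) (block T)
  block-dominating {T} dT with longBlock? T
  ... | no _ =
    extend-false-true-dominating dT ∷
    extend-true-dominating true (Dominating⇒AlmostDominating dT) ∷
    extend-true-dominating false (Dominating⇒AlmostDominating dT) ∷ []
  ... | yes (_ , _ , dT⁻) =
    extend-false-true-dominating dT ∷
    extend-true-dominating true (Dominating⇒AlmostDominating dT) ∷
    extend-true-dominating true (restriction-almostDominating dT⁻) ∷
    extend-true-dominating false (restriction-almostDominating dT⁻) ∷
    extend-true-dominating false (Dominating⇒AlmostDominating dT) ∷ []

  completion-of-dominating : ∀ {T} → Dominating G T → completion T ≡ T
  completion-of-dominating {T} dT with dominating? G T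
  ... | yes _  = refl
  ... | no ¬dT = ⊥-elim (¬dT dT)

  completion-of-removed : ∀ {T} → u ∈ T → ¬ Dominating G (T [ u ]≔ false) → completion (T [ u ]≔ false) ≡ T
  completion-of-removed {T} u∈T ¬dT⁻ with dominating? G (T [ u ]≔ false)
  ... | yes dT⁻ = ⊥-elim (¬dT⁻ dT⁻)
  ... | no _    = ∈⇒[]≔false[]≔true u∈T

  owner-extend-dominating : ∀ {T} → Dominating G T → ∀ a b → owner (extend T a b) ≡ T
  owner-extend-dominating {T} dT a b = trans (owner-extend T a b) (completion-of-dominating dT)

  owner-block : ∀ {T S} → Dominating G T → S ∈ₗ block T → owner S ≡ T
  owner-block {T} dT S∈ with longBlock? T
  owner-block dT (here refl)                 | no _ = owner-extend-dominating dT _ _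
  owner-block dT (there (here refl))         | no _ = owner-extend-dominating dT _ _
  owner-block dT (there (there (here refl))) | no _ = owner-extend-dominating dT _ _
  owner-block dT (here refl)                 | yes _ = owner-extend-dominating dT _ _
  owner-block dT (there (here refl))         | yes _ = owner-extend-dominating dT _ _
  owner-block dT (there (there (here refl))) | yes (u∈T , ¬dT⁻ , _) =
    trans (owner-extend _ _ _) (completion-of-removed u∈T ¬dT⁻)
  owner-block dT (there (there (there (here refl)))) | yes (u∈T , ¬dT⁻ , _) =
    trans (owner-extend _ _ _) (completion-of-removed u∈T ¬dT⁻)
  owner-block dT (there (there (there (there (here refl))))) | yes _ = owner-extend-dominating dT _ _

  owner-dominating : ∀ {S} → Dominating H S → Dominating G (owner S)
  owner-dominating {S} dS with extension? w S
  ... | extension S₁ b with extension? v S₁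
  ...   | extension T a rewrite owner-extend T a b = completion-dominating (restriction-almostDominating dS)

  completion-long : ∀ {T} → u ∉ T → ¬ Dominating G T → AlmostDominating T → LongBlock (T [ u ]≔ true)
  completion-long {T} u∉T ¬dT dT rewrite ∉⇒[]≔true[]≔false u∉T =
    []≔-updates T u , ¬dT , extend-true-dominating false dT

  extend-∈-block : ∀ T a b → Dominating H (extend T a b) → extend T a b ∈ₗ block (completion T)
  extend-∈-block T false b dS with extend-false-dominating⇒true dS
  ... | refl rewrite completion-of-dominating (restriction-dominating dS) with longBlock? T
  ...   | yes _ = here refl
  ...   | no _  = here refl
  extend-∈-block T true b dS with dominating? G T
  extend-∈-block T true true  dS | yes _ with longBlock? T
  ... | yes _ = there (here refl)
  ... | no _  = there (here refl)
  extend-∈-block T true false dS | yes _ with longBlock? T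
  ... | yes _ = there (there (there (there (here refl))))
  ... | no _  = there (there (here refl))
  extend-∈-block T true b dS | no ¬dT with u ∈? T
  ... | yes u∈T = ⊥-elim (¬dT (AlmostDominating-∈ (restriction-almostDominating dS) u∈T))
  ... | no u∉T with longBlock? (T [ u ]≔ true)
  ...   | no ¬long = ⊥-elim (¬long (completion-long u∉T ¬dT (restriction-almostDominating dS)))
  ...   | yes _ rewrite ∉⇒[]≔true[]≔false u∉T = removed-∈ b
    where
    removed-∈ : ∀ {A B C T₀} b →
      extend T₀ true b ∈ₗ A ∷ B ∷ extend T₀ true true ∷ extend T₀ true false ∷ C ∷ []
    removed-∈ true  = there (there (here refl))
    removed-∈ false = there (there (there (here refl)))

  ∈-block-owner : ∀ {S} → Dominating H S → S ∈ₗ block (owner S)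
  ∈-block-owner {S} dS with extension? w S
  ... | extension S₁ b with extension? v S₁
  ...   | extension T a rewrite owner-extend T a b = extend-∈-block T a b dS

  decomposition : BlockDecomposition G H
  decomposition = record
    { block            = block
    ; source           = λ T → extend T false true
    ; target           = λ T → extend T true false
    ; head-block       = head-block
    ; last-block       = last-block
    ; block-path       = block-path
    ; block-unique     = block-unique
    ; source-adj       = λ {T} {T'} adj → extend-adj false true (proj₂ (DomAdj⇒DiffersOnlyAt T T' adj))
    ; target-adj       = λ {T} {T'} adj → extend-adj true false (proj₂ (DomAdj⇒DiffersOnlyAt T T' adj))
    ; block-dominating = block-dominating
    ; owner            = owner
    ; owner-block      = owner-block
    ; owner-dominating = owner-dominating
    ; ∈-block-owner    = ∈-block-owner
    }
    where
    head-block : ∀ T → head (block T) ≡ just (extend T false true)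
    head-block T with longBlock? T
    ... | yes _ = refl
    ... | no _  = refl
    last-block : ∀ T → last (block T) ≡ just (extend T true false)
    last-block T with longBlock? T
    ... | yes _ = refl
    ... | no _  = refl

operationI-lift : ∀ {m} (H : Graph (suc m)) u v x → u ≢ v → u ≢ x → v ≢ x →
  NbhdIs₁ H u x → NbhdIs₁ H v x → HasHamiltonPathDom (delete H v) → HasHamiltonPathDom H
operationI-lift H u v x u≢v u≢x v≢x N-u N-v with punched? v u | punched? v x
... | pivot     | _         = ⊥-elim (u≢v refl)
... | _         | pivot     = ⊥-elim (v≢x refl)
... | punched _ | punched _ = BlockDecomposition.lift-hamiltonPath
  (OperationI.decomposition H v (λ { refl → u≢x refl }) N-u N-v)

operationII-lift : ∀ {m} (H : Graph (suc (suc m))) u v w (u≢v : u ≢ v) → u ≢ w → (w≢v : w ≢ v) →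
  NbhdIs₂ H v u w → NbhdIs₁ H w v →
  HasHamiltonPathDom (delete (delete H w) (punchOut w≢v)) → HasHamiltonPathDom H
operationII-lift H u v w u≢v u≢w w≢v N-v N-w with punched? w v | punched? w u
... | pivot      | _          = ⊥-elim (w≢v refl)
... | _          | pivot      = ⊥-elim (u≢w refl)
... | punched v' | punched u₁ with punched? v' u₁
...   | pivot     = ⊥-elim (u≢v refl)
...   | punched _ =
  BlockDecomposition.lift-hamiltonPath (OperationII.decomposition H w v' N-v N-w) ∘
  subst (λ v'' → HasHamiltonPathDom (delete (delete H w) v''))
    (trans (punchOut-cong w refl) (punchOut-punchIn w))

corollary2p3 : ∀ {m n} (H : Graph m) (H' : Graph n) →
    Reduces H H' → HasHamiltonPathDom H' → HasHamiltonPathDom H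
corollary2p3 H H' done = λ p → p
corollary2p3 H H' (opI u v x u≢v u≢x v≢x N-u N-v r) =
  operationI-lift H u v x u≢v u≢x v≢x N-u N-v ∘ corollary2p3 (delete H v) H' r
corollary2p3 H H' (opII u v w u≢v u≢w w≢v N-v N-w r) =
  operationII-lift H u v w u≢v u≢w w≢v N-v N-w ∘ corollary2p3 _ H' r
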